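{- Let $n\ge2$ and let $\sigma\in D_n$ have E-code $e=(e_1,\ldots,e_n)$. Then $$inv_D(\sigma)=\sum_{r=1}^n\bigl(r-e_r-2\chi(e_r<0)\bigr)\qquad\text{and}\qquad nmin_D(\sigma)=n-\sum_{r=1}^n\chi(e_r=r).$$
   Context: $D_n$ is the set of signed permutations $\sigma=\sigma_1\cdots\sigma_n$ of $[n]$ (each $|\sigma_i|$ distinct in $[n]$, signs arbitrary) with an even number of negative entries; $\bar i$ denotes $-i$. $\chi$ denotes the indicator function. $inv_D(\sigma)=|\{(i,j):1\le i<j\le n,\sigma_i>\sigma_j\}|+|\{(i,j):1\le i<j\le n,-\sigma_i>\sigma_j\}|$. $nmin_D(\sigma)=|\{i:\sigma_i>|\sigma_j|\text{ for some }j>i\}|+|\{i:\sigma_i<-1\}|$. E-code: set $\sigma^{(n)}=\sigma$; for $i=n,n-1,\ldots,2$, given $\sigma^{(i)}\in D_i$: if $i$ appears with positive sign at position $p$ of $\sigma^{(i)}$, set $e_i=p$ and let $\sigma^{(i-1)}$ be $\sigma^{(i)}$ with the entry $i$ deleted; if $\bar i$ appears at position $p$, set $e_i=-p$, delete the entry $\bar i$, and then change the sign of the entry at the first position, obtaining $\sigma^{(i-1)}\in D_{i-1}$. Finally $e_1=1$. The E-code of $\sigma$ is $(e_1,\ldots,e_n)$. -}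

module Defs where

open import Data.Nat as ℕ using (ℕ; zero; suc)
open import Data.Nat.Divisibility using (_∣_)
open import Data.Integer as ℤ using (ℤ; +_; -_; _-_; ∣_∣)
open import Data.Bool using (Bool; true; false; if_then_else_)
open import Data.Fin using (Fin; _<_)
open import Data.Fin.Properties using (_<?_)
open import Data.List using (List; []; _∷_; length; filter; map; upTo; allFin; cartesianProduct; _++_; zipWith; foldr)
open import Data.List.Relation.Binary.Permutation.Propositional using (_↭_)
open import Data.List.Relation.Unary.Any using (Any)
open import Data.List.Relation.Unary.Any.Properties using ()
import Data.List.Relation.Unary.Any as Any
open import Data.Vec using (Vec; lookup; toList)
open import Data.Product using (_×_; _,_; proj₁; proj₂)
open import Relation.Nullary using (Dec; yes; no; _×-dec_)
open import Relation.Nullary.Decidable using (⌊_⌋)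
open import Relation.Binary.PropositionalEquality using (_≡_)

-- A signed permutation of [n] is a vector σ = σ₁ ⋯ σₙ of integers
-- (position i of the paper is the Fin index i, i.e. 1-based position toℕ i + 1).

negCount : List ℤ → ℕ
negCount xs = length (filter (λ x → x ℤ.<? + 0) xs)

InD : (n : ℕ) → Vec ℤ n → Set
InD n σ = (map ∣_∣ (toList σ) ↭ map suc (upTo n)) × (2 ∣ negCount (toList σ))

invD : (n : ℕ) → Vec ℤ n → ℕ
invD n σ =
  length (filter (λ p → (proj₁ p <? proj₂ p) ×-dec (lookup σ (proj₂ p) ℤ.<? lookup σ (proj₁ p)))
                 (cartesianProduct (allFin n) (allFin n)))
  ℕ.+
  length (filter (λ p → (proj₁ p <? proj₂ p) ×-dec (lookup σ (proj₂ p) ℤ.<? - lookup σ (proj₁ p)))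
                 (cartesianProduct (allFin n) (allFin n)))

nminD : (n : ℕ) → Vec ℤ n → ℕ
nminD n σ =
  length (filter (λ i → Any.any? (λ j → (i <? j) ×-dec (+ ∣ lookup σ j ∣ ℤ.<? lookup σ i)) (allFin n))
                 (allFin n))
  ℕ.+
  length (filter (λ i → lookup σ i ℤ.<? - (+ 1)) (allFin n))

-- 1-based position of the first occurrence of x in xs (junk 0-offset if absent)
position : ℤ → List ℤ → ℕ
position x [] = 0
position x (y ∷ ys) with x ℤ.≟ y
... | yes _ = 1
... | no  _ = suc (position x ys)

deleteFirst : ℤ → List ℤ → List ℤ
deleteFirst x [] = []
deleteFirst x (y ∷ ys) with x ℤ.≟ y
... | yes _ = ys
... | no  _ = y ∷ deleteFirst x ys

flipFirst : List ℤ → List ℤ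
flipFirst [] = []
flipFirst (y ∷ ys) = - y ∷ ys

occurs : ℤ → List ℤ → Bool
occurs x [] = false
occurs x (y ∷ ys) = if ⌊ x ℤ.≟ y ⌋ then true else occurs x ys

-- eCodeAux i τ, for τ ∈ D_i, returns (e_1, …, e_i)
eCodeAux : ℕ → List ℤ → List ℤ
eCodeAux zero τ = []
eCodeAux (suc zero) τ = + 1 ∷ []
eCodeAux (suc (suc k)) τ =
  if occurs (+ i) τ
    then eCodeAux (suc k) (deleteFirst (+ i) τ) ++ (+ position (+ i) τ ∷ [])
    else eCodeAux (suc k) (flipFirst (deleteFirst (- (+ i)) τ)) ++ (- (+ position (- (+ i)) τ) ∷ [])
  where i = suc (suc k)

eCode : (n : ℕ) → Vec ℤ n → List ℤ
eCode n σ = eCodeAux n (toList σ)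

sumℤ : List ℤ → ℤ
sumℤ = foldr ℤ._+_ (+ 0)

χneg : ℤ → ℤ
χneg e = if ⌊ e ℤ.<? + 0 ⌋ then + 1 else + 0

invSum : List ℤ → ℤ
invSum e = sumℤ (zipWith (λ r er → + r - er - (+ 2) ℤ.* χneg er) (map suc (upTo (length e))) e)

fixCount : List ℤ → ℕ
fixCount e = length (filter (λ p → proj₂ p ℤ.≟ + proj₁ p)
                            (zipWith _,_ (map suc (upTo (length e))) e))

module Submission where

-- Both statistics are computed by peeling off the entry ±n of largest absolute value, as the
-- E-code does.  If σ = α (+n) β, the entry +n is in exactly |β| inversions (all of the first
-- kind) and counts in nmin iff β ≠ ∅; correspondingly e_n = |α| + 1 contributes n − e_n = |β|,
-- and e_n = n iff β = ∅.  If σ = α (−n) β, the entry −n is in 2|α| + |β| inversions and always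
-- counts in nmin (n ≥ 2); correspondingly e_n = −(|α| + 1) contributes n + |α| + 1 − 2 and is not
-- a fixed point.  Finally, negating the first entry changes neither statistic: it swaps the two
-- kinds of inversions of the head, and the head counts in nmin iff its absolute value is at
-- least 2 (then ±1 occurs later), whatever its sign.

open import Defs
open import Level using (Level)
open import Function using (_∘_; _$_; id)
open import Data.Bool using (Bool; true; false; _∧_; _∨_; not; if_then_else_)
open import Data.Bool.Properties using (∨-zeroʳ)
open import Data.Bool.ListAction using (any; or)
open import Data.Nat as ℕ using (ℕ; zero; suc; _+_; _≤_; z≤n; s≤s)
import Data.Nat.Properties as ℕ
open import Data.Nat.ListAction using (sum)
open import Data.Nat.ListAction.Properties using (sum-++)
open import Data.Nat.Tactic.RingSolver using (solve-∀)
import Algebra.Properties.CommutativeSemigroup ℕ.+-commutativeSemigroup as +-CS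
open import Data.Integer as ℤ using (ℤ; +_; -_; -[1+_]; ∣_∣; _-_)
import Data.Integer.Properties as ℤ
import Data.Integer.Tactic.RingSolver as ℤ-Solver
open import Data.Fin as Fin using (Fin)
open import Data.Fin.Properties using (_<?_)
open import Data.List
  using (List; []; _∷_; _++_; [_]; _∷ʳ_; length; map; filter; null; applyUpTo; upTo; allFin; cartesianProduct; zipWith)
open import Data.List.Properties
  using (map-++; map-∘; map-cong; map-tabulate; length-++; length-map; length-upTo; ++-identityʳ; map-upTo; applyUpTo-∷ʳ)
open import Data.List.Relation.Unary.All as All using (All; []; _∷_)
import Data.List.Relation.Unary.All.Properties as AllP
open import Data.List.Relation.Unary.Any as Any using (Any; here; there)
import Data.List.Relation.Unary.Any.Properties as AnyP
open import Data.List.Membership.Propositional using (_∈_; _∉_)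
open import Data.List.Membership.Propositional.Properties
  using (∈-map⁺; ∈-map⁻; ∈-upTo⁺; ∈-upTo⁻; ∈-∃++; ∈-++⁺ˡ; ∈-++⁺ʳ)
open import Data.List.Membership.DecPropositional ℤ._≟_ using (_∈?_)
open import Data.List.Relation.Binary.Permutation.Propositional using (_↭_; ↭-sym)
open import Data.List.Relation.Binary.Permutation.Propositional.Properties
  using (All-resp-↭; ∈-resp-↭; drop-mid; ↭-length; ↭-singleton-inv)
open import Data.Vec as Vec using (Vec; lookup; toList)
open import Data.Product using (_×_; _,_; proj₁; proj₂)
open import Data.Sum using (_⊎_; inj₁; inj₂)
open import Relation.Nullary using (Dec; does; yes; no; _×-dec_; contradiction)
open import Relation.Nullary.Decidable using (dec-true; dec-false)
open import Relation.Unary using (Pred; Decidable)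
open import Relation.Binary.PropositionalEquality hiding ([_])
open ≡-Reasoning

private variable
  ℓ : Level
  A B C : Set
  n : ℕ

χ : Bool → ℕ
χ true  = 1
χ false = 0

count : (A → Bool) → List A → ℕ
count p xs = sum (map (χ ∘ p) xs)

length-filter≡count : ∀ {P : Pred A ℓ} (P? : Decidable P) xs →
  length (filter P? xs) ≡ count (λ x → does (P? x)) xs
length-filter≡count P? [] = refl
length-filter≡count P? (x ∷ xs) with does (P? x)
... | true  = cong suc (length-filter≡count P? xs)
... | false = length-filter≡count P? xs

does-any? : ∀ {P : Pred A ℓ} (P? : Decidable P) xs →
  does (Any.any? P? xs) ≡ any (λ x → does (P? x)) xs
does-any? P? [] = refl
does-any? P? (x ∷ xs) = cong (does (P? x) ∨_) (does-any? P? xs)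

count-++ : (p : A → Bool) (xs ys : List A) → count p (xs ++ ys) ≡ count p xs + count p ys
count-++ p xs ys = trans (cong sum (map-++ (χ ∘ p) xs ys)) (sum-++ (map (χ ∘ p) xs) _)

count-map : (p : B → Bool) (f : A → B) (xs : List A) → count p (map f xs) ≡ count (p ∘ f) xs
count-map p f xs = cong sum (sym (map-∘ xs))

count-cartesianProduct : (p : A × B → Bool) (xs : List A) (ys : List B) →
  count p (cartesianProduct xs ys) ≡ sum (map (λ x → count (λ y → p (x , y)) ys) xs)
count-cartesianProduct p [] ys = refl
count-cartesianProduct p (x ∷ xs) ys =
  trans (count-++ p (map (x ,_) ys) _)
        (cong₂ _+_ (count-map p (x ,_) ys) (count-cartesianProduct p xs ys))

count-middle : (p : A → Bool) (α β : List A) (x : A) → count p (α ++ x ∷ β) ≡ χ (p x) + count p (α ++ β)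
count-middle p [] β x = refl
count-middle p (a ∷ α) β x =
  trans (cong (_+_ (χ (p a))) (count-middle p α β x)) (+-CS.x∙yz≈y∙xz (χ (p a)) (χ (p x)) _)

count-true : (p : A → Bool) {xs : List A} → All (λ y → p y ≡ true) xs → count p xs ≡ length xs
count-true p [] = refl
count-true p (px ∷ pxs) rewrite px = cong suc (count-true p pxs)

count-false : (p : A → Bool) {xs : List A} → All (λ y → p y ≡ false) xs → count p xs ≡ 0
count-false p [] = refl
count-false p (px ∷ pxs) rewrite px = count-false p pxs

any-middle : (p : A → Bool) (α β : List A) {x : A} → p x ≡ false → any p (α ++ x ∷ β) ≡ any p (α ++ β)
any-middle p [] β px rewrite px = refl
any-middle p (a ∷ α) β px = cong (p a ∨_) (any-middle p α β px)

any-false : (p : A → Bool) {xs : List A} → All (λ y → p y ≡ false) xs → any p xs ≡ false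
any-false p [] = refl
any-false p (px ∷ pxs) rewrite px = any-false p pxs

any-true : (p : A → Bool) {xs : List A} → Any (λ y → p y ≡ true) xs → any p xs ≡ true
any-true p {x ∷ xs} (here px) rewrite px = refl
any-true p {x ∷ xs} (there pxs) rewrite any-true p pxs = ∨-zeroʳ (p x)

any-all-true : (p : A → Bool) {xs : List A} → All (λ y → p y ≡ true) xs → any p xs ≡ not (null xs)
any-all-true p [] = refl
any-all-true p (px ∷ _) rewrite px = refl

map-allFin-suc : (h : Fin (suc n) → A) → map h (allFin (suc n)) ≡ h Fin.zero ∷ map (h ∘ Fin.suc) (allFin n)
map-allFin-suc h = cong (h Fin.zero ∷_) (trans (map-tabulate Fin.suc h) (sym (map-tabulate id (h ∘ Fin.suc))))

count-allFin-suc : (p : Fin (suc n) → Bool) → count p (allFin (suc n)) ≡ χ (p Fin.zero) + count (p ∘ Fin.suc) (allFin n)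
count-allFin-suc p = cong sum (map-allFin-suc (χ ∘ p))

any-allFin-suc : (p : Fin (suc n) → Bool) → any p (allFin (suc n)) ≡ p Fin.zero ∨ any (p ∘ Fin.suc) (allFin n)
any-allFin-suc p = cong or (map-allFin-suc p)

map-lookup-allFin : (σ : Vec A n) → map (lookup σ) (allFin n) ≡ toList σ
map-lookup-allFin Vec.[] = refl
map-lookup-allFin (x Vec.∷ σ) =
  trans (map-allFin-suc (lookup (x Vec.∷ σ))) (cong (x ∷_) (map-lookup-allFin σ))

count-lookup-allFin : (p : A → Bool) (σ : Vec A n) → count (p ∘ lookup σ) (allFin n) ≡ count p (toList σ)
count-lookup-allFin p σ = trans (sym (count-map p (lookup σ) (allFin _))) (cong (count p) (map-lookup-allFin σ))

any-lookup-allFin : (p : A → Bool) (σ : Vec A n) → any (p ∘ lookup σ) (allFin n) ≡ any p (toList σ)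
any-lookup-allFin {n = n} p σ =
  trans (cong or (map-∘ {g = p} {f = lookup σ} (allFin n))) (cong (any p) (map-lookup-allFin σ))

countPairs : (A → A → Bool) → List A → ℕ
countPairs r [] = 0
countPairs r (x ∷ xs) = count (r x) xs + countPairs r xs

countHasLater : (A → A → Bool) → List A → ℕ
countHasLater r [] = 0
countHasLater r (x ∷ xs) = χ (any (r x) xs) + countHasLater r xs

countPairs-lookup : (r : A → A → Bool) (σ : Vec A n) →
  sum (map (λ i → count (λ j → does (i <? j) ∧ r (lookup σ i) (lookup σ j)) (allFin n)) (allFin n))
    ≡ countPairs r (toList σ)
countPairs-lookup r Vec.[] = refl
countPairs-lookup {n = suc n} r (x Vec.∷ σ) = begin
  sum (map row (allFin (suc n)))
    ≡⟨ cong sum (map-allFin-suc row) ⟩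
  row Fin.zero + sum (map (row ∘ Fin.suc) (allFin n))
    ≡⟨ cong₂ _+_ (count-allFin-suc (later Fin.zero))
                 (cong sum (map-cong (count-allFin-suc ∘ later ∘ Fin.suc) (allFin n))) ⟩
  count (r x ∘ lookup σ) (allFin n)
    + sum (map (λ i → count (λ j → does (i <? j) ∧ r (lookup σ i) (lookup σ j)) (allFin n)) (allFin n))
    ≡⟨ cong₂ _+_ (count-lookup-allFin (r x) σ) (countPairs-lookup r σ) ⟩
  countPairs r (toList (x Vec.∷ σ)) ∎
  where
  later : Fin (suc n) → Fin (suc n) → Bool
  later i j = does (i <? j) ∧ r (lookup (x Vec.∷ σ) i) (lookup (x Vec.∷ σ) j)
  row : Fin (suc n) → ℕ
  row i = count (later i) (allFin (suc n))

countHasLater-lookup : (r : A → A → Bool) (σ : Vec A n) →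
  count (λ i → any (λ j → does (i <? j) ∧ r (lookup σ i) (lookup σ j)) (allFin n)) (allFin n)
    ≡ countHasLater r (toList σ)
countHasLater-lookup r Vec.[] = refl
countHasLater-lookup {n = suc n} r (x Vec.∷ σ) = begin
  count hasLater (allFin (suc n))
    ≡⟨ count-allFin-suc hasLater ⟩
  χ (hasLater Fin.zero) + count (hasLater ∘ Fin.suc) (allFin n)
    ≡⟨ cong₂ _+_ (cong χ (any-allFin-suc (later Fin.zero)))
                 (cong sum (map-cong (cong χ ∘ any-allFin-suc ∘ later ∘ Fin.suc) (allFin n))) ⟩
  χ (any (r x ∘ lookup σ) (allFin n))
    + count (λ i → any (λ j → does (i <? j) ∧ r (lookup σ i) (lookup σ j)) (allFin n)) (allFin n)
    ≡⟨ cong₂ _+_ (cong χ (any-lookup-allFin (r x) σ)) (countHasLater-lookup r σ) ⟩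
  countHasLater r (toList (x Vec.∷ σ)) ∎
  where
  later : Fin (suc n) → Fin (suc n) → Bool
  later i j = does (i <? j) ∧ r (lookup (x Vec.∷ σ) i) (lookup (x Vec.∷ σ) j)
  hasLater : Fin (suc n) → Bool
  hasLater i = any (later i) (allFin (suc n))

module _ {R : A → A → Set} (R? : ∀ x y → Dec (R x y)) where

  countPairs-filter : (σ : Vec A n) →
    length (filter (λ p → (proj₁ p <? proj₂ p) ×-dec R? (lookup σ (proj₁ p)) (lookup σ (proj₂ p)))
                   (cartesianProduct (allFin n) (allFin n)))
      ≡ countPairs (λ x y → does (R? x y)) (toList σ)
  countPairs-filter {n} σ =
    trans (length-filter≡count later? (cartesianProduct (allFin n) (allFin n)))
      (trans (count-cartesianProduct (λ p → does (later? p)) (allFin n) (allFin n))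
        (countPairs-lookup (λ x y → does (R? x y)) σ))
    where
    later? : (p : Fin n × Fin n) → Dec _
    later? p = (proj₁ p <? proj₂ p) ×-dec R? (lookup σ (proj₁ p)) (lookup σ (proj₂ p))

  countHasLater-filter : (σ : Vec A n) →
    length (filter (λ i → Any.any? (λ j → (i <? j) ×-dec R? (lookup σ i) (lookup σ j)) (allFin n)) (allFin n))
      ≡ countHasLater (λ x y → does (R? x y)) (toList σ)
  countHasLater-filter {n} σ =
    trans (length-filter≡count hasLater? (allFin n))
      (trans (cong sum (map-cong (λ i → cong χ (does-any? (later? i) (allFin n))) (allFin n)))
        (countHasLater-lookup (λ x y → does (R? x y)) σ))
    where
    later? : (i j : Fin n) → Dec _
    later? i j = (i <? j) ×-dec R? (lookup σ i) (lookup σ j)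
    hasLater? : (i : Fin n) → Dec _
    hasLater? i = Any.any? (later? i) (allFin n)

countPairs-middle : (r : A → A → Bool) (α β : List A) (x : A) →
  countPairs r (α ++ x ∷ β) ≡ countPairs r (α ++ β) + count (λ a → r a x) α + count (r x) β
countPairs-middle r [] β x =
  trans (ℕ.+-comm (count (r x) β) _) (cong (_+ count (r x) β) (sym (ℕ.+-identityʳ _)))
countPairs-middle r (a ∷ α) β x = begin
  count (r a) (α ++ x ∷ β) + countPairs r (α ++ x ∷ β)
    ≡⟨ cong₂ _+_ (count-middle (r a) α β x) (countPairs-middle r α β x) ⟩
  (χ (r a x) + count (r a) (α ++ β)) + (countPairs r (α ++ β) + count (λ a → r a x) α + count (r x) β)
    ≡⟨ rearrange (χ (r a x)) (count (r a) (α ++ β)) (countPairs r (α ++ β)) _ _ ⟩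
  count (r a) (α ++ β) + countPairs r (α ++ β) + (χ (r a x) + count (λ a → r a x) α) + count (r x) β ∎
  where
  rearrange : ∀ a b c d e → (a + b) + (c + d + e) ≡ (b + c) + (a + d) + e
  rearrange = solve-∀

countHasLater-middle : (r : A → A → Bool) (α β : List A) {x : A} → All (λ a → r a x ≡ false) α →
  countHasLater r (α ++ x ∷ β) ≡ countHasLater r (α ++ β) + χ (any (r x) β)
countHasLater-middle r [] β [] = ℕ.+-comm _ (countHasLater r β)
countHasLater-middle r (a ∷ α) β (rax ∷ rαx)
  rewrite any-middle (r a) α β rax | countHasLater-middle r α β rαx =
  sym (ℕ.+-assoc (χ (any (r a) (α ++ β))) _ _)

-- inv_D and nmin_D as statistics of lists

inversion negInversion exceedsAbs : ℤ → ℤ → Bool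
inversion x y = does (y ℤ.<? x)
negInversion x y = does (y ℤ.<? - x)
exceedsAbs x y = does (+ ∣ y ∣ ℤ.<? x)

belowMinusOne : ℤ → Bool
belowMinusOne y = does (y ℤ.<? - + 1)

invList : List ℤ → ℕ
invList τ = countPairs inversion τ + countPairs negInversion τ

nminList : List ℤ → ℕ
nminList τ = countHasLater exceedsAbs τ + count belowMinusOne τ

invD≡invList : (σ : Vec ℤ n) → invD n σ ≡ invList (toList σ)
invD≡invList σ = cong₂ _+_ (countPairs-filter (λ x y → y ℤ.<? x) σ) (countPairs-filter (λ x y → y ℤ.<? - x) σ)

nminD≡nminList : (σ : Vec ℤ n) → nminD n σ ≡ nminList (toList σ)
nminD≡nminList σ = cong₂ _+_ (countHasLater-filter (λ x y → + ∣ y ∣ ℤ.<? x) σ)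
  (trans (length-filter≡count (λ i → lookup σ i ℤ.<? - + 1) (allFin _)) (count-lookup-allFin belowMinusOne σ))

invList-middle : (α β : List ℤ) (x : ℤ) →
  invList (α ++ x ∷ β) ≡ invList (α ++ β)
    + (count (λ a → inversion a x) α + count (λ a → negInversion a x) α)
    + (count (inversion x) β + count (negInversion x) β)
invList-middle α β x =
  trans (cong₂ _+_ (countPairs-middle inversion α β x) (countPairs-middle negInversion α β x))
        (rearrange (countPairs inversion (α ++ β)) _ _ (countPairs negInversion (α ++ β)) _ _)
  where
  rearrange : ∀ p a b q c d → (p + a + b) + (q + c + d) ≡ (p + q) + (a + c) + (b + d)
  rearrange = solve-∀

nminList-middle : (α β : List ℤ) {x : ℤ} → All (λ a → exceedsAbs a x ≡ false) α →
  nminList (α ++ x ∷ β) ≡ nminList (α ++ β) + (χ (any (exceedsAbs x) β) + χ (belowMinusOne x))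
nminList-middle α β {x} αx =
  trans (cong₂ _+_ (countHasLater-middle exceedsAbs α β αx) (count-middle belowMinusOne α β x))
        (rearrange (countHasLater exceedsAbs (α ++ β)) _ _ (count belowMinusOne (α ++ β)))
  where
  rearrange : ∀ h e b c → (h + e) + (b + c) ≡ (h + c) + (e + b)
  rearrange = solve-∀

-- Inserting an entry of larger absolute value than all others

InRange : ℕ → ℤ → Set
InRange k y = -[1+ k ] ℤ.< y × y ℤ.< + suc k

∣i∣<1+n⇒InRange : ∀ i → ∣ i ∣ ℕ.< suc n → InRange n i
∣i∣<1+n⇒InRange (+ _)    i<n = ℤ.-<+ , ℤ.+<+ i<n
∣i∣<1+n⇒InRange -[1+ _ ] i<n = ℤ.-<- (ℕ.≤-pred i<n) , ℤ.-<+

InRange⇒∣i∣<1+n : ∀ {i} → InRange n i → ∣ i ∣ ℕ.< suc n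
InRange⇒∣i∣<1+n {i = + _}      (_ , ℤ.+<+ i<n) = i<n
InRange⇒∣i∣<1+n {i = -[1+ _ ]} (ℤ.-<- n<i , _) = s≤s n<i

module _ {k : ℕ} (α β : List ℤ) (αβ-inRange : All (InRange k) (α ++ β)) where

  private
    α-inRange : All (InRange k) α
    α-inRange = proj₁ (AllP.++⁻ α αβ-inRange)

    β-inRange : All (InRange k) β
    β-inRange = proj₂ (AllP.++⁻ α αβ-inRange)

    neg-inRange : ∀ {y} → InRange k y → InRange k (- y)
    neg-inRange (lower , upper) = ℤ.neg-mono-< upper , ℤ.neg-mono-< lower

    <-top : ∀ {y} → InRange k y → does (y ℤ.<? + suc k) ≡ true
    <-top (_ , upper) = dec-true (_ ℤ.<? _) upper

    top-≮ : ∀ {y} → InRange k y → does (+ suc k ℤ.<? y) ≡ false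
    top-≮ (_ , upper) = dec-false (_ ℤ.<? _) (ℤ.<-asym upper)

    abs-<-top : ∀ {y} → InRange k y → does (+ ∣ y ∣ ℤ.<? + suc k) ≡ true
    abs-<-top y-inRange = dec-true (_ ℤ.<? _) (ℤ.+<+ (InRange⇒∣i∣<1+n y-inRange))

    bottom-< : ∀ {y} → InRange k y → does (-[1+ k ] ℤ.<? y) ≡ true
    bottom-< (lower , _) = dec-true (_ ℤ.<? _) lower

    ≮-bottom : ∀ {y} → InRange k y → does (y ℤ.<? -[1+ k ]) ≡ false
    ≮-bottom (lower , _) = dec-false (_ ℤ.<? _) (ℤ.<-asym lower)

  invList-insert-max⁺ : invList (α ++ + suc k ∷ β) ≡ invList (α ++ β) + length β
  invList-insert-max⁺ = begin
    invList (α ++ + suc k ∷ β)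
      ≡⟨ invList-middle α β (+ suc k) ⟩
    invList (α ++ β) + (count (λ a → inversion a (+ suc k)) α + count (λ a → negInversion a (+ suc k)) α)
                     + (count (inversion (+ suc k)) β + count (negInversion (+ suc k)) β)
      ≡⟨ cong₂ (λ u v → invList (α ++ β) + u + v)
           (cong₂ _+_ (count-false (λ a → inversion a (+ suc k)) (All.map top-≮ α-inRange))
                      (count-false (λ a → negInversion a (+ suc k)) (All.map (top-≮ ∘ neg-inRange) α-inRange)))
           (cong₂ _+_ (count-true (inversion (+ suc k)) (All.map <-top β-inRange))
                      (count-false (negInversion (+ suc k)) (All.map ≮-bottom β-inRange))) ⟩
    invList (α ++ β) + 0 + (length β + 0)
      ≡⟨ simplify (invList (α ++ β)) (length β) ⟩
    invList (α ++ β) + length β ∎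
    where
    simplify : ∀ i b → i + 0 + (b + 0) ≡ i + b
    simplify = solve-∀

  invList-insert-max⁻ : invList (α ++ -[1+ k ] ∷ β) ≡ invList (α ++ β) + (length α + length α + length β)
  invList-insert-max⁻ = begin
    invList (α ++ -[1+ k ] ∷ β)
      ≡⟨ invList-middle α β -[1+ k ] ⟩
    invList (α ++ β) + (count (λ a → inversion a -[1+ k ]) α + count (λ a → negInversion a -[1+ k ]) α)
                     + (count (inversion -[1+ k ]) β + count (negInversion -[1+ k ]) β)
      ≡⟨ cong₂ (λ u v → invList (α ++ β) + u + v)
           (cong₂ _+_ (count-true (λ a → inversion a -[1+ k ]) (All.map bottom-< α-inRange))
                      (count-true (λ a → negInversion a -[1+ k ]) (All.map (bottom-< ∘ neg-inRange) α-inRange)))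
           (cong₂ _+_ (count-false (inversion -[1+ k ]) (All.map ≮-bottom β-inRange))
                      (count-true (negInversion -[1+ k ]) (All.map <-top β-inRange))) ⟩
    invList (α ++ β) + (length α + length α) + length β
      ≡⟨ ℕ.+-assoc (invList (α ++ β)) _ _ ⟩
    invList (α ++ β) + (length α + length α + length β) ∎

  nminList-insert-max⁺ : nminList (α ++ + suc k ∷ β) ≡ nminList (α ++ β) + χ (not (null β))
  nminList-insert-max⁺ = begin
    nminList (α ++ + suc k ∷ β)
      ≡⟨ nminList-middle α β {+ suc k} (All.map top-≮ α-inRange) ⟩
    nminList (α ++ β) + (χ (any (exceedsAbs (+ suc k)) β) + 0)
      ≡⟨ cong (λ b → nminList (α ++ β) + (χ b + 0))
              (any-all-true (exceedsAbs (+ suc k)) (All.map abs-<-top β-inRange)) ⟩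
    nminList (α ++ β) + (χ (not (null β)) + 0)
      ≡⟨ cong (_+_ (nminList (α ++ β))) (ℕ.+-identityʳ _) ⟩
    nminList (α ++ β) + χ (not (null β)) ∎

  nminList-insert-max⁻ : nminList (α ++ -[1+ k ] ∷ β) ≡ nminList (α ++ β) + χ (belowMinusOne -[1+ k ])
  nminList-insert-max⁻ =
    trans (nminList-middle α β { -[1+ k ]} (All.map top-≮ α-inRange))
          (cong (λ b → nminList (α ++ β) + (χ b + χ (belowMinusOne -[1+ k ])))
                (any-false (exceedsAbs -[1+ k ]) (All.map (λ _ → refl) β-inRange)))

-- Negating the first entry

invList-flipFirst : (τ : List ℤ) → invList (flipFirst τ) ≡ invList τ
invList-flipFirst [] = refl
invList-flipFirst (x ∷ xs) = begin
  (count (negInversion x) xs + countPairs inversion xs) + (count (negInversion (- x)) xs + countPairs negInversion xs)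
    ≡⟨ cong (λ c → (count (negInversion x) xs + countPairs inversion xs) + (c + countPairs negInversion xs))
            (cong (λ z → count (λ y → does (y ℤ.<? z)) xs) (ℤ.neg-involutive x)) ⟩
  (count (negInversion x) xs + countPairs inversion xs) + (count (inversion x) xs + countPairs negInversion xs)
    ≡⟨ exchange (count (negInversion x) xs) _ (count (inversion x) xs) _ ⟩
  (count (inversion x) xs + countPairs inversion xs) + (count (negInversion x) xs + countPairs negInversion xs) ∎
  where
  exchange : ∀ a p b q → (a + p) + (b + q) ≡ (b + p) + (a + q)
  exchange = solve-∀

nminList-∷ : (x : ℤ) (xs : List ℤ) →
  nminList (x ∷ xs) ≡ (χ (any (exceedsAbs x) xs) + χ (belowMinusOne x)) + nminList xs
nminList-∷ x xs = rearrange (χ (any (exceedsAbs x) xs)) (countHasLater exceedsAbs xs) (χ (belowMinusOne x)) _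
  where
  rearrange : ∀ a h b c → (a + h) + (b + c) ≡ (a + b) + (h + c)
  rearrange = solve-∀

nminList-head : (x : ℤ) (xs : List ℤ) → All (λ y → 1 ≤ ∣ y ∣) xs → (2 ≤ ∣ x ∣ → 1 ∈ map ∣_∣ xs) →
  χ (any (exceedsAbs x) xs) + χ (belowMinusOne x) ≡ χ (1 ℕ.<ᵇ ∣ x ∣)
nminList-head (+ zero) xs xs-pos _ =
  cong (λ b → χ b + 0) (any-false (exceedsAbs (+ 0)) (All.map (λ _ → refl) xs-pos))
nminList-head (+ suc zero) xs xs-pos _ =
  cong (λ b → χ b + 0) (any-false (exceedsAbs (+ 1)) (All.map (λ {y} → ∣y∣≮1 {y}) xs-pos))
  where
  ∣y∣≮1 : ∀ {y} → 1 ≤ ∣ y ∣ → exceedsAbs (+ 1) y ≡ false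
  ∣y∣≮1 {y} 1≤∣y∣ = dec-false (+ ∣ y ∣ ℤ.<? + 1) λ { (ℤ.+<+ ∣y∣<1) → ℕ.<⇒≱ ∣y∣<1 1≤∣y∣ }
nminList-head (+ suc (suc n)) xs _ one∈xs =
  cong (λ b → χ b + 0) (any-true (exceedsAbs (+ suc (suc n)))
    (Any.map (λ {y} → one<2+n {y}) (AnyP.map⁻ (one∈xs (s≤s (s≤s z≤n))))))
  where
  one<2+n : ∀ {y} → 1 ≡ ∣ y ∣ → exceedsAbs (+ suc (suc n)) y ≡ true
  one<2+n 1≡∣y∣ = subst (λ a → does (+ a ℤ.<? + suc (suc n)) ≡ true) 1≡∣y∣ refl
nminList-head -[1+ zero ] xs xs-pos _ =
  cong (λ b → χ b + 0) (any-false (exceedsAbs -[1+ 0 ]) (All.map (λ _ → refl) xs-pos))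
nminList-head -[1+ suc n ] xs xs-pos _ =
  cong (λ b → χ b + 1) (any-false (exceedsAbs -[1+ suc n ]) (All.map (λ _ → refl) xs-pos))

nminList-negateHead : (x : ℤ) (xs : List ℤ) → All (λ y → 1 ≤ ∣ y ∣) xs → (2 ≤ ∣ x ∣ → 1 ∈ map ∣_∣ xs) →
  nminList (- x ∷ xs) ≡ nminList (x ∷ xs)
nminList-negateHead x xs xs-pos one∈xs = begin
  nminList (- x ∷ xs)
    ≡⟨ nminList-∷ (- x) xs ⟩
  (χ (any (exceedsAbs (- x)) xs) + χ (belowMinusOne (- x))) + nminList xs
    ≡⟨ cong (_+ nminList xs) (nminList-head (- x) xs xs-pos (one∈xs ∘ subst (2 ≤_) (ℤ.∣-i∣≡∣i∣ x))) ⟩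
  χ (1 ℕ.<ᵇ ∣ - x ∣) + nminList xs
    ≡⟨ cong (λ a → χ (1 ℕ.<ᵇ a) + nminList xs) (ℤ.∣-i∣≡∣i∣ x) ⟩
  χ (1 ℕ.<ᵇ ∣ x ∣) + nminList xs
    ≡⟨ cong (_+ nminList xs) (nminList-head x xs xs-pos one∈xs) ⟨
  (χ (any (exceedsAbs x) xs) + χ (belowMinusOne x)) + nminList xs
    ≡⟨ nminList-∷ x xs ⟨
  nminList (x ∷ xs) ∎

record SignedPerm (n : ℕ) (τ : List ℤ) : Set where
  constructor signedPerm
  field abs-↭ : map ∣_∣ τ ↭ map suc (upTo n)

open SignedPerm

map-suc-upTo-suc : ∀ n → map suc (upTo (suc n)) ≡ map suc (upTo n) ∷ʳ suc n
map-suc-upTo-suc n = begin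
  map suc (upTo (suc n))     ≡⟨ map-upTo suc (suc n) ⟩
  applyUpTo suc (suc n)      ≡⟨ applyUpTo-∷ʳ suc n ⟨
  applyUpTo suc n ∷ʳ suc n   ≡⟨ cong (_∷ʳ suc n) (map-upTo suc n) ⟨
  map suc (upTo n) ∷ʳ suc n  ∎

map-∣∣-flipFirst : (τ : List ℤ) → map ∣_∣ (flipFirst τ) ≡ map ∣_∣ τ
map-∣∣-flipFirst [] = refl
map-∣∣-flipFirst (x ∷ xs) = cong (_∷ map ∣_∣ xs) (ℤ.∣-i∣≡∣i∣ x)

module _ {n : ℕ} {τ : List ℤ} (τ-perm : SignedPerm n τ) where

  SignedPerm-length : length τ ≡ n
  SignedPerm-length =
    trans (sym (length-map ∣_∣ τ)) (trans (↭-length (abs-↭ τ-perm)) (trans (length-map suc (upTo n)) (length-upTo n)))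

  SignedPerm-bounds : All (λ y → 1 ≤ ∣ y ∣ × ∣ y ∣ ≤ n) τ
  SignedPerm-bounds = AllP.map⁻ (All-resp-↭ (↭-sym (abs-↭ τ-perm))
    (AllP.map⁺ {P = λ a → 1 ≤ a × a ≤ n} (All.tabulate (λ a∈upTo → s≤s z≤n , ∈-upTo⁻ a∈upTo))))

  SignedPerm-inRange : All (InRange n) τ
  SignedPerm-inRange = All.map (λ {y} bounds → ∣i∣<1+n⇒InRange y (s≤s (proj₂ bounds))) SignedPerm-bounds

  SignedPerm-∈ : ∀ {a} → 1 ≤ a → a ≤ n → a ∈ map ∣_∣ τ
  SignedPerm-∈ {suc a} _ a<n = ∈-resp-↭ (↭-sym (abs-↭ τ-perm)) (∈-map⁺ suc (∈-upTo⁺ a<n))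

  SignedPerm-∉ : ∀ {y} → n ℕ.< ∣ y ∣ → y ∉ τ
  SignedPerm-∉ n<∣y∣ y∈τ = ℕ.<⇒≱ n<∣y∣ (proj₂ (All.lookup SignedPerm-bounds y∈τ))

  SignedPerm-flipFirst : SignedPerm n (flipFirst τ)
  SignedPerm-flipFirst = signedPerm (subst (_↭ map suc (upTo n)) (sym (map-∣∣-flipFirst τ)) (abs-↭ τ-perm))

SignedPerm-deleteMax : ∀ {n} α β {y} → ∣ y ∣ ≡ suc n → SignedPerm (suc n) (α ++ y ∷ β) → SignedPerm n (α ++ β)
SignedPerm-deleteMax {n} α β {y} ∣y∣≡1+n τ-perm = signedPerm $
  subst₂ _↭_ (sym (map-++ ∣_∣ α β)) (++-identityʳ (map suc (upTo n)))
    (drop-mid (map ∣_∣ α) (map suc (upTo n))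
      (subst₂ _↭_ (trans (map-++ ∣_∣ α (y ∷ β)) (cong (λ a → map ∣_∣ α ++ a ∷ map ∣_∣ β) ∣y∣≡1+n))
                  (map-suc-upTo-suc n) (abs-↭ τ-perm)))

SignedPerm-one : ∀ {τ} → SignedPerm 1 τ → τ ≡ [ + 1 ] ⊎ τ ≡ [ -[1+ 0 ] ]
SignedPerm-one {τ} τ-perm with τ | ↭-singleton-inv (abs-↭ τ-perm)
... | + _      ∷ [] | refl = inj₁ refl
... | -[1+ _ ] ∷ [] | refl = inj₂ refl

nminList-flipFirst : ∀ {n τ} → SignedPerm n τ → nminList (flipFirst τ) ≡ nminList τ
nminList-flipFirst {τ = []} _ = refl
nminList-flipFirst {n} {x ∷ xs} τ-perm with SignedPerm-bounds τ-perm
... | (1≤∣x∣ , ∣x∣≤n) ∷ xs-bounds =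
  nminList-negateHead x xs (All.map (λ {y} → proj₁ {B = λ _ → ∣ y ∣ ≤ n}) xs-bounds) one∈xs
  where
  one∈xs : 2 ≤ ∣ x ∣ → 1 ∈ map ∣_∣ xs
  one∈xs 2≤∣x∣ with SignedPerm-∈ τ-perm ℕ.≤-refl (ℕ.≤-trans 1≤∣x∣ ∣x∣≤n)
  ... | here 1≡∣x∣ = contradiction (subst (2 ≤_) (sym 1≡∣x∣) 2≤∣x∣) λ { (s≤s ()) }
  ... | there 1∈xs = 1∈xs

-- The E-code recursion

occurs≡does-∈? : ∀ x xs → occurs x xs ≡ does (x ∈? xs)
occurs≡does-∈? x [] = refl
occurs≡does-∈? x (y ∷ ys) with x ℤ.≟ y
... | yes _ = refl
... | no  _ = occurs≡does-∈? x ys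

occurs-∈ : ∀ {x xs} → x ∈ xs → occurs x xs ≡ true
occurs-∈ {x} {xs} x∈xs = trans (occurs≡does-∈? x xs) (dec-true (x ∈? xs) x∈xs)

occurs-∉ : ∀ {x xs} → x ∉ xs → occurs x xs ≡ false
occurs-∉ {x} {xs} x∉xs = trans (occurs≡does-∈? x xs) (dec-false (x ∈? xs) x∉xs)

∉-insert : ∀ {x y : A} α {β} → x ∉ α ++ β → x ≢ y → x ∉ α ++ y ∷ β
∉-insert []      x∉β   x≢y (here x≡y) = x≢y x≡y
∉-insert []      x∉β   x≢y (there x∈β) = x∉β x∈β
∉-insert (a ∷ α) x∉a∷αβ x≢y (here x≡a) = x∉a∷αβ (here x≡a)
∉-insert (a ∷ α) x∉a∷αβ x≢y (there x∈) = ∉-insert α (x∉a∷αβ ∘ there) x≢y x∈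

position-middle : ∀ {x} α β → x ∉ α → position x (α ++ x ∷ β) ≡ suc (length α)
position-middle {x} [] β _ with x ℤ.≟ x
... | yes _   = refl
... | no  x≢x = contradiction refl x≢x
position-middle {x} (a ∷ α) β x∉a∷α with x ℤ.≟ a
... | yes x≡a = contradiction (here x≡a) x∉a∷α
... | no  _   = cong suc (position-middle α β (x∉a∷α ∘ there))

deleteFirst-middle : ∀ {x} α β → x ∉ α → deleteFirst x (α ++ x ∷ β) ≡ α ++ β
deleteFirst-middle {x} [] β _ with x ℤ.≟ x
... | yes _   = refl
... | no  x≢x = contradiction refl x≢x
deleteFirst-middle {x} (a ∷ α) β x∉a∷α with x ℤ.≟ a
... | yes x≡a = contradiction (here x≡a) x∉a∷α
... | no  _   = cong (a ∷_) (deleteFirst-middle α β (x∉a∷α ∘ there))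

module _ (k : ℕ) (τ : List ℤ) where

  private
    positiveCode negativeCode : List ℤ
    positiveCode = eCodeAux (suc k) (deleteFirst (+ suc (suc k)) τ) ∷ʳ + position (+ suc (suc k)) τ
    negativeCode = eCodeAux (suc k) (flipFirst (deleteFirst -[1+ suc k ] τ)) ∷ʳ - + position -[1+ suc k ] τ

  eCodeAux-occurs : occurs (+ suc (suc k)) τ ≡ true → eCodeAux (suc (suc k)) τ ≡ positiveCode
  eCodeAux-occurs = cong (λ b → if b then positiveCode else negativeCode)

  eCodeAux-¬occurs : occurs (+ suc (suc k)) τ ≡ false → eCodeAux (suc (suc k)) τ ≡ negativeCode
  eCodeAux-¬occurs = cong (λ b → if b then positiveCode else negativeCode)

data MaxSplit (k : ℕ) : List ℤ → Set where
  positive : ∀ α β → SignedPerm (suc k) (α ++ β) →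
    eCodeAux (suc (suc k)) (α ++ + suc (suc k) ∷ β) ≡ eCodeAux (suc k) (α ++ β) ∷ʳ + suc (length α) →
    MaxSplit k (α ++ + suc (suc k) ∷ β)
  negative : ∀ α β → SignedPerm (suc k) (α ++ β) →
    eCodeAux (suc (suc k)) (α ++ -[1+ suc k ] ∷ β) ≡ eCodeAux (suc k) (flipFirst (α ++ β)) ∷ʳ -[1+ length α ] →
    MaxSplit k (α ++ -[1+ suc k ] ∷ β)

maxSplit : ∀ {k τ} → SignedPerm (suc (suc k)) τ → MaxSplit k τ
maxSplit {k} {τ} τ-perm
  with y , y∈τ , 2+k≡∣y∣ ← ∈-map⁻ ∣_∣ (SignedPerm-∈ τ-perm (s≤s z≤n) ℕ.≤-refl)
  with α , β , refl ← ∈-∃++ y∈τ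
  = split y 2+k≡∣y∣
  where
  αβ-perm : SignedPerm (suc k) (α ++ β)
  αβ-perm = SignedPerm-deleteMax α β (sym 2+k≡∣y∣) τ-perm
  max∉αβ : ∀ {x} → ∣ x ∣ ≡ suc (suc k) → x ∉ α ++ β
  max∉αβ ∣x∣≡2+k = SignedPerm-∉ αβ-perm (ℕ.≤-reflexive (sym ∣x∣≡2+k))
  split : ∀ y → suc (suc k) ≡ ∣ y ∣ → MaxSplit k (α ++ y ∷ β)
  split (+ _) refl = positive α β αβ-perm $
    trans (eCodeAux-occurs k (α ++ + suc (suc k) ∷ β) (occurs-∈ (∈-++⁺ʳ α (here {xs = β} refl))))
          (cong₂ (λ τ p → eCodeAux (suc k) τ ∷ʳ + p) (deleteFirst-middle α β x∉α) (position-middle α β x∉α))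
    where
    x∉α = max∉αβ refl ∘ ∈-++⁺ˡ
  split -[1+ _ ] refl = negative α β αβ-perm $
    trans (eCodeAux-¬occurs k (α ++ -[1+ suc k ] ∷ β) (occurs-∉ (∉-insert α (max∉αβ refl) λ ())))
          (cong₂ (λ τ p → eCodeAux (suc k) (flipFirst τ) ∷ʳ - + p)
                 (deleteFirst-middle α β x∉α) (position-middle α β x∉α))
    where
    x∉α = max∉αβ refl ∘ ∈-++⁺ˡ

length-∷ʳ : ∀ (xs : List A) x → length (xs ∷ʳ x) ≡ suc (length xs)
length-∷ʳ xs x = trans (length-++ xs) (ℕ.+-comm (length xs) 1)

length-eCodeAux : ∀ k τ → length (eCodeAux (suc k) τ) ≡ suc k
length-eCodeAux zero    τ = refl
length-eCodeAux (suc k) τ with occurs (+ suc (suc k)) τ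
... | true  = trans (length-∷ʳ (eCodeAux (suc k) _) _) (cong suc (length-eCodeAux k _))
... | false = trans (length-∷ʳ (eCodeAux (suc k) _) _) (cong suc (length-eCodeAux k _))

length-split : ∀ {k} α β τ → SignedPerm (suc k) (α ++ β) →
  length α + suc (length β) ≡ suc (length (eCodeAux (suc k) τ))
length-split {k} α β τ αβ-perm = begin
  length α + suc (length β)          ≡⟨ ℕ.+-suc (length α) (length β) ⟩
  suc (length α + length β)          ≡⟨ cong suc (length-++ α) ⟨
  suc (length (α ++ β))              ≡⟨ cong suc (SignedPerm-length αβ-perm) ⟩
  suc (suc k)                        ≡⟨ cong suc (length-eCodeAux k τ) ⟨
  suc (length (eCodeAux (suc k) τ))  ∎

zipWith-∷ʳ : (f : A → B → C) {xs : List A} {ys : List B} → length xs ≡ length ys → ∀ x y →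
  zipWith f (xs ∷ʳ x) (ys ∷ʳ y) ≡ zipWith f xs ys ∷ʳ f x y
zipWith-∷ʳ f {[]}     {[]}     _  x y = refl
zipWith-∷ʳ f {a ∷ xs} {b ∷ ys} eq x y = cong (f a b ∷_) (zipWith-∷ʳ f (ℕ.suc-injective eq) x y)

zipWith-indices-∷ʳ : (f : ℕ → A → B) (e : List A) (x : A) →
  zipWith f (map suc (upTo (length (e ∷ʳ x)))) (e ∷ʳ x) ≡ zipWith f (map suc (upTo (length e))) e ∷ʳ f (suc (length e)) x
zipWith-indices-∷ʳ f e x = begin
  zipWith f (map suc (upTo (length (e ∷ʳ x)))) (e ∷ʳ x)
    ≡⟨ cong (λ m → zipWith f (map suc (upTo m)) (e ∷ʳ x)) (length-∷ʳ e x) ⟩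
  zipWith f (map suc (upTo (suc (length e)))) (e ∷ʳ x)
    ≡⟨ cong (λ is → zipWith f is (e ∷ʳ x)) (map-suc-upTo-suc (length e)) ⟩
  zipWith f (map suc (upTo (length e)) ∷ʳ suc (length e)) (e ∷ʳ x)
    ≡⟨ zipWith-∷ʳ f (trans (length-map suc (upTo (length e))) (length-upTo (length e))) (suc (length e)) x ⟩
  zipWith f (map suc (upTo (length e))) e ∷ʳ f (suc (length e)) x ∎

invSummand : ℕ → ℤ → ℤ
invSummand r e = + r - e - + 2 ℤ.* χneg e

sumℤ-∷ʳ : ∀ xs x → sumℤ (xs ∷ʳ x) ≡ sumℤ xs ℤ.+ x
sumℤ-∷ʳ [] x = ℤ.+-comm x (+ 0)
sumℤ-∷ʳ (y ∷ xs) x = trans (cong (ℤ._+_ y) (sumℤ-∷ʳ xs x)) (sym (ℤ.+-assoc y _ x))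

invSum-∷ʳ : ∀ e x → invSum (e ∷ʳ x) ≡ invSum e ℤ.+ invSummand (suc (length e)) x
invSum-∷ʳ e x = trans (cong sumℤ (zipWith-indices-∷ʳ invSummand e x))
  (sumℤ-∷ʳ (zipWith invSummand (map suc (upTo (length e))) e) (invSummand (suc (length e)) x))

invSummand-positive : ∀ a b {r} → a + suc b ≡ r → invSummand r (+ suc a) ≡ + b
invSummand-positive a b refl = identity (+ a) (+ b)
  where
  identity : ∀ A B → (A ℤ.+ (+ 1 ℤ.+ B)) - (+ 1 ℤ.+ A) - + 2 ℤ.* + 0 ≡ B
  identity = ℤ-Solver.solve-∀

invSummand-negative : ∀ a b {r} → a + suc b ≡ r → invSummand r -[1+ a ] ≡ + (a + a + b)
invSummand-negative a b refl = identity (+ a) (+ b)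
  where
  identity : ∀ A B → (A ℤ.+ (+ 1 ℤ.+ B)) - (- (+ 1 ℤ.+ A)) - + 2 ℤ.* + 1 ≡ A ℤ.+ A ℤ.+ B
  identity = ℤ-Solver.solve-∀

fixCount-∷ʳ : ∀ e x → fixCount (e ∷ʳ x) ≡ fixCount e + χ (does (x ℤ.≟ + suc (length e)))
fixCount-∷ʳ e x = begin
  fixCount (e ∷ʳ x)
    ≡⟨ cong (length ∘ filter fixed?) (zipWith-indices-∷ʳ _,_ e x) ⟩
  length (filter fixed? (indexed ∷ʳ (suc (length e) , x)))
    ≡⟨ length-filter≡count fixed? (indexed ∷ʳ _) ⟩
  count (λ p → does (fixed? p)) (indexed ∷ʳ (suc (length e) , x))
    ≡⟨ count-++ (λ p → does (fixed? p)) indexed _ ⟩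
  count (λ p → does (fixed? p)) indexed + (χ (does (x ℤ.≟ + suc (length e))) + 0)
    ≡⟨ cong₂ _+_ (sym (length-filter≡count fixed? indexed)) (ℕ.+-identityʳ _) ⟩
  fixCount e + χ (does (x ℤ.≟ + suc (length e))) ∎
  where
  indexed : List (ℕ × ℤ)
  indexed = zipWith _,_ (map suc (upTo (length e))) e
  fixed? : (p : ℕ × ℤ) → Dec (proj₂ p ≡ + proj₁ p)
  fixed? p = proj₂ p ℤ.≟ + proj₁ p

nonempty-xor-last : ∀ (α β : List A) {m} → length α + suc (length β) ≡ suc m →
  χ (not (null β)) + χ (does (+ suc (length α) ℤ.≟ + suc m)) ≡ 1
nonempty-xor-last α [] ∣α∣+1≡1+m =
  cong χ (dec-true (_ ℤ.≟ _) (cong +_ (trans (ℕ.+-comm 1 (length α)) ∣α∣+1≡1+m)))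
nonempty-xor-last α (b ∷ β) ∣α∣+2+∣β∣≡1+m = cong (suc ∘ χ) (dec-false (_ ℤ.≟ _) λ 1+∣α∣≡1+m →
  ℕ.m+1+n≢m (length α) (ℕ.suc-injective
    (trans (sym (ℕ.+-suc (length α) _)) (trans ∣α∣+2+∣β∣≡1+m (sym (ℤ.+-injective 1+∣α∣≡1+m))))))

invList-eCode : ∀ k τ → SignedPerm (suc k) τ → + invList τ ≡ invSum (eCodeAux (suc k) τ)
invList-eCode zero τ τ-perm with SignedPerm-one τ-perm
... | inj₁ refl = refl
... | inj₂ refl = refl
invList-eCode (suc k) τ τ-perm with maxSplit τ-perm
... | positive α β αβ-perm code = begin
  + invList (α ++ + suc (suc k) ∷ β)
    ≡⟨ cong +_ (invList-insert-max⁺ α β (SignedPerm-inRange αβ-perm)) ⟩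
  + invList (α ++ β) ℤ.+ + length β
    ≡⟨ cong₂ ℤ._+_ (invList-eCode k (α ++ β) αβ-perm)
                   (sym (invSummand-positive (length α) (length β) (length-split α β (α ++ β) αβ-perm))) ⟩
  invSum e ℤ.+ invSummand (suc (length e)) (+ suc (length α))
    ≡⟨ trans (cong invSum code) (invSum-∷ʳ e _) ⟨
  invSum (eCodeAux (suc (suc k)) (α ++ + suc (suc k) ∷ β)) ∎
  where e = eCodeAux (suc k) (α ++ β)
... | negative α β αβ-perm code = begin
  + invList (α ++ -[1+ suc k ] ∷ β)
    ≡⟨ cong +_ (invList-insert-max⁻ α β (SignedPerm-inRange αβ-perm)) ⟩
  + invList (α ++ β) ℤ.+ + (length α + length α + length β)
    ≡⟨ cong (λ i → + i ℤ.+ + (length α + length α + length β)) (invList-flipFirst (α ++ β)) ⟨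
  + invList (flipFirst (α ++ β)) ℤ.+ + (length α + length α + length β)
    ≡⟨ cong₂ ℤ._+_ (invList-eCode k (flipFirst (α ++ β)) (SignedPerm-flipFirst αβ-perm))
                   (sym (invSummand-negative (length α) (length β) (length-split α β (flipFirst (α ++ β)) αβ-perm))) ⟩
  invSum e ℤ.+ invSummand (suc (length e)) -[1+ length α ]
    ≡⟨ trans (cong invSum code) (invSum-∷ʳ e _) ⟨
  invSum (eCodeAux (suc (suc k)) (α ++ -[1+ suc k ] ∷ β)) ∎
  where e = eCodeAux (suc k) (flipFirst (α ++ β))

nminList-eCode : ∀ k τ → SignedPerm (suc k) τ → nminList τ + fixCount (eCodeAux (suc k) τ) ≡ suc k
nminList-eCode zero τ τ-perm with SignedPerm-one τ-perm
... | inj₁ refl = refl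
... | inj₂ refl = refl
nminList-eCode (suc k) τ τ-perm with maxSplit τ-perm
... | positive α β αβ-perm code = begin
  nminList (α ++ + suc (suc k) ∷ β) + fixCount (eCodeAux (suc (suc k)) (α ++ + suc (suc k) ∷ β))
    ≡⟨ cong₂ _+_ (nminList-insert-max⁺ α β (SignedPerm-inRange αβ-perm))
                 (trans (cong fixCount code) (fixCount-∷ʳ e _)) ⟩
  (nminList (α ++ β) + χ (not (null β))) + (fixCount e + χ (does (+ suc (length α) ℤ.≟ + suc (length e))))
    ≡⟨ +-CS.interchange (nminList (α ++ β)) (χ (not (null β))) (fixCount e) _ ⟩
  (nminList (α ++ β) + fixCount e) + (χ (not (null β)) + χ (does (+ suc (length α) ℤ.≟ + suc (length e))))
    ≡⟨ cong₂ _+_ (nminList-eCode k (α ++ β) αβ-perm) (nonempty-xor-last α β (length-split α β (α ++ β) αβ-perm)) ⟩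
  suc k + 1
    ≡⟨ ℕ.+-comm (suc k) 1 ⟩
  suc (suc k) ∎
  where e = eCodeAux (suc k) (α ++ β)
... | negative α β αβ-perm code = begin
  nminList (α ++ -[1+ suc k ] ∷ β) + fixCount (eCodeAux (suc (suc k)) (α ++ -[1+ suc k ] ∷ β))
    ≡⟨ cong₂ _+_ (nminList-insert-max⁻ α β (SignedPerm-inRange αβ-perm))
                 (trans (cong fixCount code) (fixCount-∷ʳ e _)) ⟩
  (nminList (α ++ β) + 1) + (fixCount e + 0)
    ≡⟨ cong (λ m → (m + 1) + (fixCount e + 0)) (nminList-flipFirst αβ-perm) ⟨
  (nminList (flipFirst (α ++ β)) + 1) + (fixCount e + 0)
    ≡⟨ +-CS.interchange (nminList (flipFirst (α ++ β))) 1 (fixCount e) 0 ⟩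
  (nminList (flipFirst (α ++ β)) + fixCount e) + 1
    ≡⟨ cong (_+ 1) (nminList-eCode k (flipFirst (α ++ β)) (SignedPerm-flipFirst αβ-perm)) ⟩
  suc k + 1
    ≡⟨ ℕ.+-comm (suc k) 1 ⟩
  suc (suc k) ∎
  where e = eCodeAux (suc k) (flipFirst (α ++ β))

+a≡+[a+b]-+b : ∀ a b → + a ≡ + (a + b) - + b
+a≡+[a+b]-+b a b = identity (+ a) (+ b)
  where
  identity : ∀ A B → A ≡ (A ℤ.+ B) - B
  identity = ℤ-Solver.solve-∀

proposition4p4 : (n : ℕ) → 2 ≤ n → (σ : Vec ℤ n) → InD n σ →
    (+ invD n σ ≡ invSum (eCode n σ)) × (+ nminD n σ ≡ + n - + fixCount (eCode n σ))
proposition4p4 (suc k) _ σ (abs-↭σ , _) =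
  trans (cong +_ (invD≡invList σ)) (invList-eCode k (toList σ) σ-perm) ,
  (begin
    + nminD (suc k) σ                   ≡⟨ cong +_ (nminD≡nminList σ) ⟩
    + nminList (toList σ)               ≡⟨ +a≡+[a+b]-+b (nminList (toList σ)) (fixCount e) ⟩
    + (nminList (toList σ) + fixCount e) - + fixCount e
                                        ≡⟨ cong (λ m → + m - + fixCount e) (nminList-eCode k (toList σ) σ-perm) ⟩
    + suc k - + fixCount e              ∎)
  where
  σ-perm = signedPerm abs-↭σ
  e = eCode (suc k) σ
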